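{- For every $k\in\mathbb{N}$, every graph of cliquewidth at most $k$ admits a decomposition of diversity at most $k$ that is governed by the class of bipartite graphs.
   Context: Cliquewidth: a $k$-labelled graph is a graph with a map $\lambda\colon V(G)\to[k]$; operations are $\mathsf{join}_{i,j}$ ($i\ne j$; add all edges between label-$i$ and label-$j$ vertices), $\mathsf{rename}_{i\to j}$ (relabel $i$ to $j$), and $\mathsf{union}$ (disjoint union). The cliquewidth of $G$ is the least $k$ such that some $k$-labelling of $G$ can be built from single-vertex $k$-labelled graphs by these operations. A decomposition of a graph $G=(V,E)$ is a pair $(T,\eta)$ with $T$ a rooted tree and $\eta\colon V\to V(T)$ any map. For an edge $e=uv$, $\eta(e)$ is the least common ancestor of $\eta(u),\eta(v)$. For a node $x$: $V_x=\{v:\eta(v)\text{ is a descendant of }x\}$ (nodes are their own descendants), $E_x=\{e:\eta(e)=x\}$, $G_x=(V_x,E_x)$. The decomposition is governed by a class $\mathcal{C}$ if $G_x\in\mathcal{C}$ for all nodes $x$. The diversity of a node $x$ is the number of classes of the equivalence $u\sim_x v\iff N^G(u)\setminus V_x=N^G(v)\setminus V_x$ on $V_x$; the diversity of the decomposition is the maximum over nodes. -}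

module Defs where

open import Data.Nat using (ℕ; _+_)
open import Data.Fin using (Fin; splitAt; _≟_)
open import Data.Bool using (Bool; true; false; _∨_; _∧_; if_then_else_)
open import Data.Sum using (_⊎_; inj₁; inj₂)
open import Data.Product using (Σ; ∃; _×_; _,_)
open import Data.List using (List; length; lookup)
open import Relation.Nullary using (¬_; does; yes; no)
open import Relation.Binary.PropositionalEquality using (_≡_; _≢_; refl)
open import Function.Bundles using (_↔_; Inverse)

record Graph (n : ℕ) : Set where
  field
    adj   : Fin n → Fin n → Bool
    sym   : ∀ u v → adj u v ≡ adj v u
    irrefl : ∀ u → adj u u ≡ false
open Graph public

-- k-expressions (cliquewidth terms), indexed by the number of vertices.
-- Vertices of a term with n vertices are Fin n; union places the left
-- operand's vertices first.

data Expr (k : ℕ) : ℕ → Set where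
  vtx    : Fin k → Expr k 1
  union  : ∀ {m n} → Expr k m → Expr k n → Expr k (m + n)
  join   : ∀ {n} (i j : Fin k) → i ≢ j → Expr k n → Expr k n
  rename : ∀ {n} (i j : Fin k) → Expr k n → Expr k n

_==_ : ∀ {k} → Fin k → Fin k → Bool
a == b = does (a ≟ b)

label : ∀ {k n} → Expr k n → Fin n → Fin k
label (vtx c) _ = c
label (union {m} e f) x with splitAt m x
... | inj₁ a = label e a
... | inj₂ b = label f b
label (join i j _ e) x = label e x
label (rename i j e) x = if label e x == i then j else label e x

eadj : ∀ {k n} → Expr k n → Fin n → Fin n → Bool
eadj (vtx _) _ _ = false
eadj (union {m} e f) x y with splitAt m x | splitAt m y
... | inj₁ a | inj₁ b = eadj e a b
... | inj₂ a | inj₂ b = eadj f a b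
... | inj₁ _ | inj₂ _ = false
... | inj₂ _ | inj₁ _ = false
eadj (join i j _ e) x y =
  eadj e x y ∨ ((label e x == i ∧ label e y == j) ∨ (label e x == j ∧ label e y == i))
eadj (rename i j e) x y = eadj e x y

CliquewidthAtMost : ∀ {n} → ℕ → Graph n → Set
CliquewidthAtMost {n} k G =
  Σ (Expr k n) λ e → Σ (Fin n ↔ Fin n) λ σ →
    ∀ x y → eadj e x y ≡ adj G (Inverse.to σ x) (Inverse.to σ y)

data Tree : Set where
  node : List Tree → Tree

-- A node of a tree, given as the path from the root.
data Node : Tree → Set where
  here  : ∀ {t} → Node t
  there : ∀ {ts} (i : Fin (length ts)) → Node (lookup ts i) → Node (node ts)

-- x ≼ y : y is a descendant of x (every node is its own descendant).
data _≼_ : ∀ {t} → Node t → Node t → Set where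
  here≼  : ∀ {t} {y : Node t} → here ≼ y
  there≼ : ∀ {ts} {i : Fin (length ts)} {p q : Node (lookup ts i)} →
           p ≼ q → there {ts} i p ≼ there {ts} i q

lca : ∀ {t} → Node t → Node t → Node t
lca here _ = here
lca (there i p) here = here
lca {node ts} (there i p) (there j q) with i ≟ j
... | yes refl = there {ts} i (lca p q)
... | no _ = here

record Decomposition (n : ℕ) : Set where
  field
    tree : Tree
    η    : Fin n → Node tree
open Decomposition public

module _ {n : ℕ} (G : Graph n) (D : Decomposition n) where

  InV : Node (tree D) → Fin n → Set
  InV x v = x ≼ η D v

  InE : Node (tree D) → Fin n → Fin n → Set
  InE x u v = adj G u v ≡ true × lca (η D u) (η D v) ≡ x

  NodeBipartite : Node (tree D) → Set
  NodeBipartite x = Σ (Fin n → Bool) λ c →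
    ∀ u v → InV x u → InV x v → InE x u v → c u ≢ c v

  GovernedByBipartite : Set
  GovernedByBipartite = ∀ x → NodeBipartite x

  Equiv : Node (tree D) → Fin n → Fin n → Set
  Equiv x u v = ∀ w → ¬ InV x w → adj G u w ≡ adj G v w

  -- the number of ∼_x classes on V_x is at most k: there is a map
  -- V_x → Fin k whose fibres are exactly the classes
  NodeDiversityAtMost : ℕ → Node (tree D) → Set
  NodeDiversityAtMost k x = Σ (Fin n → Fin k) λ f →
    ∀ u v → InV x u → InV x v → (Equiv x u v → f u ≡ f v) × (f u ≡ f v → Equiv x u v)

  DiversityAtMost : ℕ → Set
  DiversityAtMost k = ∀ x → NodeDiversityAtMost k x

-- Given a k-expression e generating G (up to the isomorphism σ), take as
-- decomposition tree the parse tree of e with join and rename nodes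
-- contracted: union nodes become binary nodes, single-vertex terms become
-- leaves, and every vertex is mapped to its leaf.  Two facts about this tree,
-- each proved by induction on e along the node x, give the theorem.
--   * Bipartiteness: two distinct vertices whose leaves meet exactly at x lie
--     on different sides of the union at x, so "which side" 2-colours G_x.
--   * Diversity: the labels in the subterm at x classify V_x: equally labelled
--     vertices get the same final label and the same neighbours outside V_x,
--     because all later edges are added by joins, which only see labels.
--     A map V_x → Fin k refining ∼_x is upgraded to one whose fibres are exactly
--     the ∼_x-classes by sending each vertex to the label of the least vertex
--     of its class (a general fact about decidable equivalences on Fin n).
-- Finally both facts are transported along σ to G itself.

module Submission where

open import Defs hiding (sym)
open import Data.Nat using (ℕ; zero; suc; _+_)
open import Data.Fin using (Fin; zero; suc; splitAt; _≟_) renaming (join to joinFin)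
open import Data.Fin.Properties using (join-splitAt; all?)
open import Data.Bool using (Bool; true; false; _∨_; _∧_; if_then_else_)
open import Data.Bool.Properties using () renaming (_≟_ to _≟ᵇ_)
open import Data.List using ([]; _∷_)
open import Data.Maybe using (Maybe; just; nothing; maybe)
import Data.Maybe as Maybe
open import Data.Sum using (inj₁; inj₂; [_,_]′)
open import Data.Product using (Σ; ∃; _×_; _,_; proj₁; proj₂)
open import Data.Empty using (⊥-elim)
open import Function using (_∘_)
open import Function.Bundles using (_↔_; Inverse; Injection; mk⇔)
open import Function.Properties.Inverse using (↔-sym; ↔⇒↣)
open import Relation.Nullary using (¬_; Dec; yes; no; does)
open import Relation.Nullary.Decidable using (map′; ¬?; _×-dec_; _→-dec_; does-⇔; dec-true)
open import Level using (0ℓ)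
open import Relation.Unary using (Pred)
open import Relation.Binary using (Rel; IsEquivalence)
import Relation.Binary as B
open import Relation.Binary.PropositionalEquality

firstᵇ : ∀ {n} → (Fin n → Bool) → Maybe (Fin n)
firstᵇ {zero}  p = nothing
firstᵇ {suc n} p = if p zero then just zero else Maybe.map suc (firstᵇ (p ∘ suc))

firstᵇ-cong : ∀ {n} {p q : Fin n → Bool} → (∀ i → p i ≡ q i) → firstᵇ p ≡ firstᵇ q
firstᵇ-cong {zero}  p≗q = refl
firstᵇ-cong {suc n} p≗q =
  cong₂ (λ b r → if b then just zero else Maybe.map suc r) (p≗q zero) (firstᵇ-cong (p≗q ∘ suc))

firstᵇ-sound : ∀ {n} (p : Fin n → Bool) {i} → firstᵇ p ≡ just i → p i ≡ true
firstᵇ-sound {suc n} p eq with p zero in p₀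
firstᵇ-sound {suc n} p refl | true = p₀
... | false with firstᵇ (p ∘ suc) in rest
firstᵇ-sound {suc n} p refl | false | just j = firstᵇ-sound (p ∘ suc) rest

firstᵇ-complete : ∀ {n} (p : Fin n → Bool) i → p i ≡ true → ∃ λ j → firstᵇ p ≡ just j
firstᵇ-complete {suc n} p i pᵢ with p zero in p₀
... | true = zero , refl
firstᵇ-complete {suc n} p zero    pᵢ | false with () ← trans (sym p₀) pᵢ
firstᵇ-complete {suc n} p (suc i) pᵢ | false with firstᵇ-complete (p ∘ suc) i pᵢ
... | j , eq = suc j , cong (Maybe.map suc) eq

-- If the fibres of lab refine a decidable equivalence E on a decidable
-- subset P of Fin n, then some map into Fin k has exactly the E-classes of P
-- as its fibres: send each vertex to the label of the least element of P in
-- its class.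
classifier : ∀ {n k} {P : Pred (Fin n) 0ℓ} {E : Rel (Fin n) 0ℓ} →
  (∀ v → Dec (P v)) → B.Decidable E → IsEquivalence E → (lab : Fin n → Fin k) →
  (∀ u v → P u → P v → lab u ≡ lab v → E u v) →
  Σ (Fin n → Fin k) λ f → ∀ u v → P u → P v → (E u v → f u ≡ f v) × (f u ≡ f v → E u v)
classifier {n} {k} {P} {E} P? E? isEq lab lab-refines =
  f , λ u v Pu Pv → sound u v Pu Pv , exact u v Pu Pv
  where
  open IsEquivalence isEq renaming (refl to E-refl; sym to E-sym; trans to E-trans)

  candidate : Fin n → Fin n → Bool
  candidate u v = does (P? v ×-dec E? u v)

  rep : Fin n → Maybe (Fin n)
  rep u = firstᵇ (candidate u)

  f : Fin n → Fin k
  f u = maybe lab (lab u) (rep u)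

  rep-exists : ∀ u → P u → ∃ λ r → rep u ≡ just r
  rep-exists u Pu = firstᵇ-complete (candidate u) u (dec-true (P? u ×-dec E? u u) (Pu , E-refl))

  rep-valid : ∀ u {r} → rep u ≡ just r → P r × E u r
  rep-valid u {r} eq with P? r | E? u r | firstᵇ-sound (candidate u) eq
  ... | yes Pr | yes u∼r | _  = Pr , u∼r
  ... | yes _  | no _    | ()
  ... | no _   | _       | ()

  rep-cong : ∀ {u v} → E u v → rep u ≡ rep v
  rep-cong u∼v = firstᵇ-cong λ w → does-⇔
    (mk⇔ (λ (Pw , u∼w) → Pw , E-trans (E-sym u∼v) u∼w) (λ (Pw , v∼w) → Pw , E-trans u∼v v∼w))
    (P? w ×-dec E? _ w) (P? w ×-dec E? _ w)

  f-rep : ∀ u {r} → rep u ≡ just r → f u ≡ lab r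
  f-rep u = cong (maybe lab (lab u))

  sound : ∀ u v → P u → P v → E u v → f u ≡ f v
  sound u v Pu Pv u∼v with rep-exists u Pu
  ... | r , rep-u = trans (f-rep u rep-u) (sym (f-rep v (trans (sym (rep-cong u∼v)) rep-u)))

  exact : ∀ u v → P u → P v → f u ≡ f v → E u v
  exact u v Pu Pv fu≡fv with rep-exists u Pu | rep-exists v Pv
  ... | r , rep-u | s , rep-v with rep-valid u rep-u | rep-valid v rep-v
  ... | Pr , u∼r | Ps , v∼s =
    E-trans u∼r (E-trans (lab-refines r s Pr Ps lr≡ls) (E-sym v∼s))
    where
    lr≡ls : lab r ≡ lab s
    lr≡ls = trans (sym (f-rep u rep-u)) (trans fu≡fv (f-rep v rep-v))

_≼?_ : ∀ {t} (x y : Node t) → Dec (x ≼ y)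
here      ≼? y = yes here≼
there i p ≼? here = no λ ()
there i p ≼? there j q with i ≟ j
... | no i≢j  = no λ { (there≼ _) → i≢j refl }
... | yes refl = map′ there≼ (λ { (there≼ p≼q) → p≼q }) (p ≼? q)

splitAt-injective : ∀ m {n} (u v : Fin (m + n)) → splitAt m u ≡ splitAt m v → u ≡ v
splitAt-injective m {n} u v eq = begin
  u                         ≡⟨ sym (join-splitAt m n u) ⟩
  joinFin m n (splitAt m u) ≡⟨ cong (joinFin m n) eq ⟩
  joinFin m n (splitAt m v) ≡⟨ join-splitAt m n v ⟩
  v                         ∎
  where open ≡-Reasoning

exprTree : ∀ {k n} → Expr k n → Tree
exprTree (vtx _)        = node []
exprTree (union e f)    = node (exprTree e ∷ exprTree f ∷ [])
exprTree (join _ _ _ e) = exprTree e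
exprTree (rename _ _ e) = exprTree e

leafOf : ∀ {k n} (e : Expr k n) → Fin n → Node (exprTree e)
leafOf (vtx _)          _ = here
leafOf (union {m} e f) u with splitAt m u
... | inj₁ a = there zero (leafOf e a)
... | inj₂ b = there (suc zero) (leafOf f b)
leafOf (join _ _ _ e)   u = leafOf e u
leafOf (rename _ _ e)   u = leafOf e u

Separates : ∀ {k n} (e : Expr k n) → Node (exprTree e) → (Fin n → Bool) → Set
Separates e x c = ∀ u v → x ≼ leafOf e u → x ≼ leafOf e v →
  lca (leafOf e u) (leafOf e v) ≡ x → u ≢ v → c u ≢ c v

-- At a union node the side of the union separates; below it, the colouring
-- of the subterm extended arbitrarily to the other side; a leaf carries a
-- single vertex.
separating : ∀ {k n} (e : Expr k n) (x : Node (exprTree e)) → Σ (Fin n → Bool) (Separates e x)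
separating (vtx _) here = (λ _ → true) , λ { zero zero _ _ _ u≢v _ → u≢v refl }
separating (join _ _ _ e) x = separating e x
separating (rename _ _ e) x = separating e x
separating (union {m} {n} e f) here = side , separated
  where
  side : Fin (m + n) → Bool
  side u = [ (λ _ → true) , (λ _ → false) ]′ (splitAt m u)

  separated : Separates (union e f) here side
  separated u v _ _ _ _ with splitAt m u | splitAt m v
  separated u v _ _ () _ | inj₁ _ | inj₁ _
  separated u v _ _ () _ | inj₂ _ | inj₂ _
  ... | inj₁ _ | inj₂ _ = λ ()
  ... | inj₂ _ | inj₁ _ = λ ()
separating (union {m} {n} e f) (there zero p) = colour , separated
  where
  c : Fin m → Bool
  c = proj₁ (separating e p)

  colour : Fin (m + n) → Bool
  colour u = [ c , (λ _ → false) ]′ (splitAt m u)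

  separated : Separates (union e f) (there zero p) colour
  separated u v _ _ _ u≢v with splitAt m u in eu | splitAt m v in ev
  separated u v (there≼ pu) (there≼ pv) refl u≢v | inj₁ a | inj₁ b =
    proj₂ (separating e p) a b pu pv refl
      λ { refl → u≢v (splitAt-injective m u v (trans eu (sym ev))) }
  separated u v () _ _ _ | inj₂ _ | _
  separated u v _ () _ _ | inj₁ _ | inj₂ _
separating (union {m} {n} e f) (there (suc zero) p) = colour , separated
  where
  c : Fin n → Bool
  c = proj₁ (separating f p)

  colour : Fin (m + n) → Bool
  colour u = [ (λ _ → false) , c ]′ (splitAt m u)

  separated : Separates (union e f) (there (suc zero) p) colour
  separated u v _ _ _ u≢v with splitAt m u in eu | splitAt m v in ev
  separated u v (there≼ pu) (there≼ pv) refl u≢v | inj₂ a | inj₂ b =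
    proj₂ (separating f p) a b pu pv refl
      λ { refl → u≢v (splitAt-injective m u v (trans eu (sym ev))) }
  separated u v () _ _ _ | inj₁ _ | _
  separated u v _ () _ _ | inj₂ _ | inj₁ _

Classifies : ∀ {k n} (e : Expr k n) → Node (exprTree e) → (Fin n → Fin k) → Set
Classifies e x lab = ∀ u v → x ≼ leafOf e u → x ≼ leafOf e v → lab u ≡ lab v →
  label e u ≡ label e v × (∀ w → ¬ x ≼ leafOf e w → eadj e u w ≡ eadj e v w)

joinEdge : ∀ {k} → Fin k → Fin k → Fin k → Fin k → Bool
joinEdge i j a b = (a == i ∧ b == j) ∨ (a == j ∧ b == i)

renameLabel : ∀ {k} → Fin k → Fin k → Fin k → Fin k
renameLabel i j a = if a == i then j else a

-- At the root the final labels classify, as nothing lies outside.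
rootClassifies : ∀ {k n} (e : Expr k n) → Classifies e here (label e)
rootClassifies e u v _ _ same = same , λ w outside → ⊥-elim (outside here≼)

-- Below the root, the classifier of the operand containing x, i.e. the labels
-- in the subterm at x; joins and renames above x act on these labels only.
classifying : ∀ {k n} (e : Expr k n) (x : Node (exprTree e)) → Σ (Fin n → Fin k) (Classifies e x)
classifying (vtx c)     here = label (vtx c) , rootClassifies (vtx c)
classifying (union e f) here = label (union e f) , rootClassifies (union e f)
classifying (join i j _ e) x with classifying e x
... | lab , classified = lab , λ u v xu xv same →
  let (sameLabel , sameOutside) = classified u v xu xv same in
  sameLabel , λ w outside →
    cong₂ (λ a ℓ → a ∨ joinEdge i j ℓ (label e w)) (sameOutside w outside) sameLabel
classifying (rename i j e) x with classifying e x
... | lab , classified = lab , λ u v xu xv same →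
  let (sameLabel , sameOutside) = classified u v xu xv same in
  cong (renameLabel i j) sameLabel , sameOutside
classifying {k} (union {m} {n} e f) (there zero p) =
  lab , λ u v pu pv same → sameLabel u v pu pv same , sameOutside u v pu pv same
  where
  inner : Classifies e p (proj₁ (classifying e p))
  inner = proj₂ (classifying e p)

  lab : Fin (m + n) → Fin k
  lab u = [ proj₁ (classifying e p) , label f ]′ (splitAt m u)

  Below : Fin (m + n) → Set
  Below u = there zero p ≼ leafOf (union e f) u

  sameLabel : ∀ u v → Below u → Below v → lab u ≡ lab v → label (union e f) u ≡ label (union e f) v
  sameLabel u v _ _ _ with splitAt m u | splitAt m v
  sameLabel u v (there≼ pu) (there≼ pv) same | inj₁ a | inj₁ b = proj₁ (inner a b pu pv same)
  sameLabel u v () _ _ | inj₂ _ | _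
  sameLabel u v _ () _ | inj₁ _ | inj₂ _

  sameOutside : ∀ u v → Below u → Below v → lab u ≡ lab v →
    ∀ w → ¬ Below w → eadj (union e f) u w ≡ eadj (union e f) v w
  sameOutside u v _ _ _ w _ with splitAt m u | splitAt m v | splitAt m w
  sameOutside u v (there≼ pu) (there≼ pv) same w outside | inj₁ a | inj₁ b | inj₁ c =
    proj₂ (inner a b pu pv same) c (outside ∘ there≼)
  sameOutside u v (there≼ pu) (there≼ pv) same w outside | inj₁ a | inj₁ b | inj₂ c = refl
  sameOutside u v () _ _ w _ | inj₂ _ | _ | _
  sameOutside u v _ () _ w _ | inj₁ _ | inj₂ _ | _
classifying {k} (union {m} {n} e f) (there (suc zero) p) =
  lab , λ u v pu pv same → sameLabel u v pu pv same , sameOutside u v pu pv same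
  where
  inner : Classifies f p (proj₁ (classifying f p))
  inner = proj₂ (classifying f p)

  lab : Fin (m + n) → Fin k
  lab u = [ label e , proj₁ (classifying f p) ]′ (splitAt m u)

  Below : Fin (m + n) → Set
  Below u = there (suc zero) p ≼ leafOf (union e f) u

  sameLabel : ∀ u v → Below u → Below v → lab u ≡ lab v → label (union e f) u ≡ label (union e f) v
  sameLabel u v _ _ _ with splitAt m u | splitAt m v
  sameLabel u v (there≼ pu) (there≼ pv) same | inj₂ a | inj₂ b = proj₁ (inner a b pu pv same)
  sameLabel u v () _ _ | inj₁ _ | _
  sameLabel u v _ () _ | inj₂ _ | inj₁ _

  sameOutside : ∀ u v → Below u → Below v → lab u ≡ lab v →
    ∀ w → ¬ Below w → eadj (union e f) u w ≡ eadj (union e f) v w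
  sameOutside u v _ _ _ w _ with splitAt m u | splitAt m v | splitAt m w
  sameOutside u v (there≼ pu) (there≼ pv) same w outside | inj₂ a | inj₂ b | inj₂ c =
    proj₂ (inner a b pu pv same) c (outside ∘ there≼)
  sameOutside u v (there≼ pu) (there≼ pv) same w outside | inj₂ a | inj₂ b | inj₁ c = refl
  sameOutside u v () _ _ w _ | inj₁ _ | _ | _
  sameOutside u v _ () _ w _ | inj₂ _ | inj₁ _ | _

edge-distinct : ∀ {n} (G : Graph n) {u v} → adj G u v ≡ true → u ≢ v
edge-distinct G {u} edge refl with () ← trans (sym (irrefl G u)) edge

module _ {n} (G : Graph n) (D : Decomposition n) (x : Node (tree D)) where

  Equiv-isEquivalence : IsEquivalence (Equiv G D x)
  Equiv-isEquivalence = record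
    { refl  = λ _ _ → refl
    ; sym   = λ u∼v w outside → sym (u∼v w outside)
    ; trans = λ u∼v v∼z w outside → trans (u∼v w outside) (v∼z w outside)
    }

  Equiv-dec : B.Decidable (Equiv G D x)
  Equiv-dec u v = all? λ w → ¬? (x ≼? η D w) →-dec (adj G u w ≟ᵇ adj G v w)

module ExpressionDecomposition {k n} (G : Graph n) (e : Expr k n) (σ : Fin n ↔ Fin n)
  (generates : ∀ x y → eadj e x y ≡ adj G (Inverse.to σ x) (Inverse.to σ y)) where

  open Inverse σ using (from; strictlyInverseˡ)

  decomposition : Decomposition n
  decomposition = record { tree = exprTree e ; η = leafOf e ∘ from }

  adj-expr : ∀ u w → adj G u w ≡ eadj e (from u) (from w)
  adj-expr u w = sym (trans (generates (from u) (from w))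
                            (cong₂ (adj G) (strictlyInverseˡ u) (strictlyInverseˡ w)))

  -- The labels at x, which refine ∼_x, are refined to an exact classifier.
  diversity : DiversityAtMost G decomposition k
  diversity x = classifier (λ w → x ≼? leafOf e (from w)) (Equiv-dec G decomposition x)
    (Equiv-isEquivalence G decomposition x) (lab ∘ from) refines
    where
    lab : Fin n → Fin k
    lab = proj₁ (classifying e x)

    classified : Classifies e x lab
    classified = proj₂ (classifying e x)

    refines : ∀ u v → InV G decomposition x u → InV G decomposition x v →
      lab (from u) ≡ lab (from v) → Equiv G decomposition x u v
    refines u v xu xv same w outside = begin
      adj G u w                ≡⟨ adj-expr u w ⟩
      eadj e (from u) (from w) ≡⟨ proj₂ (classified (from u) (from v) xu xv same) (from w) outside ⟩
      eadj e (from v) (from w) ≡⟨ sym (adj-expr v w) ⟩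
      adj G v w                ∎
      where open ≡-Reasoning

  -- The separating colouring at x 2-colours G_x, whose edges join distinct
  -- vertices meeting at x.
  bipartite : GovernedByBipartite G decomposition
  bipartite x = proj₁ (separating e x) ∘ from , λ u v xu xv (edge , meet) →
    proj₂ (separating e x) (from u) (from v) xu xv meet
      (edge-distinct G edge ∘ Injection.injective (↔⇒↣ (↔-sym σ)))

lemma2p6 : (k n : ℕ) (G : Graph n) → CliquewidthAtMost k G →
    Σ (Decomposition n) λ D → DiversityAtMost G D k × GovernedByBipartite G D
lemma2p6 k n G (e , σ , generates) = decomposition , diversity , bipartite
  where open ExpressionDecomposition G e σ generates
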